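{- Let $P_n$ be the path on $n\ge 1$ vertices. Then the depth of $P_n$ produced by Algorithm 1 is $d(P_n)=\lceil \log_2 n\rceil$.
   Context: For a tree $T$, an edge $e$ is balanced if the absolute difference of the numbers of edges of the two components of $T-e$ is minimum among all edges of $T$. Algorithm 1: start with the forest $F=T$. While $F$ has a component with more than one vertex, perform an iteration: simultaneously, from each component of $F$ with more than one vertex, delete one balanced edge (balanced with respect to that component); an edge deleted in the $i$-th iteration is colored $i$. The depth $d(T)$ is the number of iterations performed. -}

module Defs where

open import Data.Nat using (ℕ; zero; suc; _∸_; _≤_; _<_; ∣_-_∣)
open import Data.List using (List; []; _∷_; _++_)
open import Data.List.Relation.Unary.All using (All)
open import Data.List.Relation.Unary.Any using (Any)
open import Data.Product using (_×_)

-- The path P k has vertices 0 , … , k-1 and edges i = {i , i+1} for i + 1 < k.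
-- Deleting edge i from P k leaves the paths P (i+1) and P (k-(i+1)).
-- Hence every component of the forest arising in Algorithm 1 started from a path
-- is again a path, and such a forest is represented by the list of vertex counts
-- of its components.

IsEdge : ℕ → ℕ → Set
IsEdge k i = suc i < k

-- numbers of edges of the two components of P k - i are  i  and  k - 2 - i
imbalance : ℕ → ℕ → ℕ
imbalance k i = ∣ i - (k ∸ 2 ∸ i) ∣

Balanced : ℕ → ℕ → Set
Balanced k i = IsEdge k i × (∀ j → IsEdge k j → imbalance k i ≤ imbalance k j)

Forest : Set
Forest = List ℕ

data CompStep : ℕ → Forest → Set where
  trivial : ∀ {k} → k ≤ 1 → CompStep k (k ∷ [])
  split   : ∀ {k i} → 1 < k → Balanced k i → CompStep k (suc i ∷ (k ∸ suc i) ∷ [])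

data Step : Forest → Forest → Set where
  []  : Step [] []
  _∷_ : ∀ {k F G H} → CompStep k G → Step F H → Step (k ∷ F) (G ++ H)

data Run : Forest → ℕ → Set where
  stop : ∀ {F} → All (_≤ 1) F → Run F 0
  iter : ∀ {F G d} → Any (1 <_) F → Step F G → Run G d → Run F (suc d)

module Submission where

-- The proof uses a potential on forests of paths: the height of a forest is
-- the largest ⌈log₂ k⌉ over its components P k.  The argument has three parts.
--  1. Balanced edges halve a path.  In P (m+2) the middle edge ⌊m/2⌋ has
--     imbalance at most 1 and is therefore balanced; consequently every
--     balanced edge has imbalance at most 1, so the larger of the two pieces
--     has exactly ⌈(m+2)/2⌉ vertices.
--  2. Every iteration lowers the height by exactly one: trivial components have
--     height 0, and splitting P k at a balanced edge gives pieces of height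
--     ⌈log₂ ⌈k/2⌉⌉ = ⌈log₂ k⌉ - 1.  Since a run stops exactly when every
--     component is trivial (height 0), every run from F has length height F.
--  3. An iteration is always possible (a balanced edge exists), so a run exists.
-- For the single path P n the height is ⌈log₂ n⌉, which gives both halves of
-- the theorem.

open import Defs
open import Data.Nat using (ℕ; _≤_)
open import Data.Nat.Logarithm using (⌈log₂_⌉)
open import Data.List using (_∷_; [])
open import Data.Product using (Σ; _×_)
open import Relation.Binary.PropositionalEquality using (_≡_)

open import Data.Nat using (zero; suc; _+_; _∸_; _<_; _⊔_; z≤n; s≤s; ⌊_/2⌋; ⌈_/2⌉; ∣_-_∣; _≤?_)
open import Data.Nat.Properties
open import Data.Nat.Logarithm using (⌈log₂⌉-mono-≤; ⌈log₂⌈n/2⌉⌉≡⌈log₂n⌉∸1; ⌈log₂2^n⌉≡n)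
open import Data.List using (_++_)
open import Data.List.Relation.Unary.All using (All; []; _∷_)
open import Data.List.Relation.Unary.Any using (Any; here; there)
open import Data.Product using (_,_; proj₁; proj₂)
open import Data.Sum using (_⊎_; inj₁; inj₂)
open import Data.Empty using (⊥-elim)
open import Relation.Nullary using (yes; no)
open import Relation.Binary.PropositionalEquality using (refl; sym; trans; cong; cong₂; subst; module ≡-Reasoning)
open ≡-Reasoning

max-of-close : ∀ i j → ∣ i - j ∣ ≤ 1 → i ⊔ j ≡ ⌈ (i + j) /2⌉
max-of-close zero          zero          _        = refl
max-of-close zero          (suc zero)    _        = refl
max-of-close (suc zero)    zero          _        = refl
max-of-close zero          (suc (suc j)) (s≤s ())
max-of-close (suc (suc i)) zero          (s≤s ())
max-of-close (suc i)       (suc j)       close rewrite +-suc i j =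
  cong suc (max-of-close i j close)

middleImbalance : ℕ → ℕ
middleImbalance m = imbalance (suc (suc m)) ⌊ m /2⌋

middleImbalance-step : ∀ m → middleImbalance (suc (suc m)) ≡ middleImbalance m
middleImbalance-step m rewrite +-∸-assoc 1 (⌊n/2⌋≤n m) = refl

middleImbalance≤1 : ∀ m → middleImbalance m ≤ 1
middleImbalance≤1 zero          = z≤n
middleImbalance≤1 (suc zero)    = s≤s z≤n
middleImbalance≤1 (suc (suc m)) rewrite middleImbalance-step m = middleImbalance≤1 m

middleImbalance-minimal : ∀ a b → middleImbalance (a + b) ≤ ∣ a - b ∣
middleImbalance-minimal zero    zero    = z≤n
middleImbalance-minimal zero    (suc b) = ≤-trans (middleImbalance≤1 (suc b)) (s≤s z≤n)
middleImbalance-minimal (suc a) zero rewrite +-identityʳ a =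
  ≤-trans (middleImbalance≤1 (suc a)) (s≤s z≤n)
middleImbalance-minimal (suc a) (suc b) rewrite +-suc a b | middleImbalance-step (a + b) =
  middleImbalance-minimal a b

middle-balanced : ∀ m → Balanced (suc (suc m)) ⌊ m /2⌋
middle-balanced m = s≤s (s≤s (⌊n/2⌋≤n m)) , minimal
  where
  minimal : ∀ j → IsEdge (suc (suc m)) j → middleImbalance m ≤ imbalance (suc (suc m)) j
  minimal j (s≤s (s≤s j≤m)) =
    subst (λ e → middleImbalance e ≤ ∣ j - (m ∸ j) ∣) (m+[n∸m]≡n j≤m)
          (middleImbalance-minimal j (m ∸ j))

-- Splitting P k (k ≥ 2) at a balanced edge leaves a largest piece of exactly
-- ⌈k/2⌉ vertices, because a balanced edge is at least as good as the middle one.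
balanced-halves : ∀ m i → Balanced (suc (suc m)) i →
  suc i ⊔ (suc (suc m) ∸ suc i) ≡ ⌈ suc (suc m) /2⌉
balanced-halves m i (s≤s (s≤s i≤m) , minimal) rewrite +-∸-assoc 1 i≤m = cong suc (begin
  i ⊔ (m ∸ i)        ≡⟨ max-of-close i (m ∸ i) close ⟩
  ⌈ (i + (m ∸ i)) /2⌉ ≡⟨ cong ⌈_/2⌉ (m+[n∸m]≡n i≤m) ⟩
  ⌈ m /2⌉             ∎)
  where
  close : ∣ i - (m ∸ i) ∣ ≤ 1
  close = ≤-trans (minimal ⌊ m /2⌋ (proj₁ (middle-balanced m))) (middleImbalance≤1 m)

height : Forest → ℕ
height []      = 0
height (k ∷ F) = ⌈log₂ k ⌉ ⊔ height F

height-++ : ∀ G H → height (G ++ H) ≡ height G ⊔ height H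
height-++ []      H = refl
height-++ (k ∷ G) H = begin
  ⌈log₂ k ⌉ ⊔ height (G ++ H)          ≡⟨ cong (⌈log₂ k ⌉ ⊔_) (height-++ G H) ⟩
  ⌈log₂ k ⌉ ⊔ (height G ⊔ height H)    ≡⟨ sym (⊔-assoc ⌈log₂ k ⌉ (height G) (height H)) ⟩
  (⌈log₂ k ⌉ ⊔ height G) ⊔ height H    ∎

trivial-height : ∀ {k} → k ≤ 1 → ⌈log₂ k ⌉ ≡ 0
trivial-height {k} k≤1 = n≤0⇒n≡0 (subst (⌈log₂ k ⌉ ≤_) (⌈log₂2^n⌉≡n 0) (⌈log₂⌉-mono-≤ k≤1))

nontrivial-height : ∀ {k} → 1 < k → 1 ≤ ⌈log₂ k ⌉
nontrivial-height {k} 1<k = subst (_≤ ⌈log₂ k ⌉) (⌈log₂2^n⌉≡n 1) (⌈log₂⌉-mono-≤ 1<k)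

all-trivial-height : ∀ {F} → All (_≤ 1) F → height F ≡ 0
all-trivial-height []                = refl
all-trivial-height (k≤1 ∷ trivials) rewrite trivial-height k≤1 = all-trivial-height trivials

some-nontrivial-height : ∀ {F} → Any (1 <_) F → 1 ≤ height F
some-nontrivial-height {k ∷ F} (here 1<k) =
  ≤-trans (nontrivial-height 1<k) (m≤m⊔n ⌈log₂ k ⌉ (height F))
some-nontrivial-height {k ∷ F} (there nontrivial) =
  ≤-trans (some-nontrivial-height nontrivial) (m≤n⊔m ⌈log₂ k ⌉ (height F))

compStep-height : ∀ {k G} → CompStep k G → height G ≡ ⌈log₂ k ⌉ ∸ 1
compStep-height (trivial k≤1) rewrite trivial-height k≤1 = refl
compStep-height (split {suc (suc m)} {i} (s≤s (s≤s z≤n)) balanced) = begin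
  ⌈log₂ suc i ⌉ ⊔ (⌈log₂ rest ⌉ ⊔ 0)  ≡⟨ cong (⌈log₂ suc i ⌉ ⊔_) (⊔-identityʳ ⌈log₂ rest ⌉) ⟩
  ⌈log₂ suc i ⌉ ⊔ ⌈log₂ rest ⌉        ≡⟨ sym (mono-≤-distrib-⊔ ⌈log₂⌉-mono-≤ (suc i) rest) ⟩
  ⌈log₂ suc i ⊔ rest ⌉                ≡⟨ cong ⌈log₂_⌉ (balanced-halves m i balanced) ⟩
  ⌈log₂ ⌈ suc (suc m) /2⌉ ⌉           ≡⟨ ⌈log₂⌈n/2⌉⌉≡⌈log₂n⌉∸1 (suc (suc m)) ⟩
  ⌈log₂ suc (suc m) ⌉ ∸ 1             ∎
  where
  rest : ℕ
  rest = suc (suc m) ∸ suc i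

-- An iteration acts componentwise, and  x ↦ x ∸ 1  commutes with maxima.
step-height : ∀ {F H} → Step F H → height H ≡ height F ∸ 1
step-height [] = refl
step-height {k ∷ F} (_∷_ {G = G} {H = H} compStep step) = begin
  height (G ++ H)                      ≡⟨ height-++ G H ⟩
  height G ⊔ height H                  ≡⟨ cong₂ _⊔_ (compStep-height compStep) (step-height step) ⟩
  (⌈log₂ k ⌉ ∸ 1) ⊔ (height F ∸ 1)     ≡⟨ sym (mono-≤-distrib-⊔ (∸-monoˡ-≤ 1) ⌈log₂ k ⌉ (height F)) ⟩
  (⌈log₂ k ⌉ ⊔ height F) ∸ 1           ∎

run-length : ∀ {F d} → Run F d → d ≡ height F
run-length (stop trivials) = sym (all-trivial-height trivials)
run-length {F} (iter nontrivial step run) = begin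
  suc _                     ≡⟨ cong suc (trans (run-length run) (step-height step)) ⟩
  suc (height F ∸ 1)        ≡⟨ m+[n∸m]≡n (some-nontrivial-height nontrivial) ⟩
  height F                  ∎

trivial-or-nontrivial : ∀ F → All (_≤ 1) F ⊎ Any (1 <_) F
trivial-or-nontrivial [] = inj₁ []
trivial-or-nontrivial (k ∷ F) with k ≤? 1 | trivial-or-nontrivial F
... | no  k≰1 | _                 = inj₂ (here (≰⇒> k≰1))
... | yes k≤1 | inj₁ trivials     = inj₁ (k≤1 ∷ trivials)
... | yes _   | inj₂ nontrivial   = inj₂ (there nontrivial)

compStep-exists : ∀ k → Σ Forest (CompStep k)
compStep-exists zero          = _ , trivial z≤n
compStep-exists (suc zero)    = _ , trivial (s≤s z≤n)
compStep-exists (suc (suc m)) = _ , split (s≤s (s≤s z≤n)) (middle-balanced m)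

step-exists : ∀ F → Σ Forest (Step F)
step-exists []      = _ , []
step-exists (k ∷ F) = _ , (proj₂ (compStep-exists k) ∷ proj₂ (step-exists F))

-- Induction on the height: each iteration lowers it by one.
run-exists : ∀ h F → height F ≡ h → Σ ℕ (Run F)
run-exists _ F _ with trivial-or-nontrivial F
... | inj₁ trivials = 0 , stop trivials
run-exists zero F height≡0 | inj₂ nontrivial =
  ⊥-elim (1+n≰n (subst (1 ≤_) height≡0 (some-nontrivial-height nontrivial)))
run-exists (suc h) F height≡1+h | inj₂ nontrivial with step-exists F
... | G , step with run-exists h G (trans (step-height step) (cong (_∸ 1) height≡1+h))
... | d , run = suc d , iter nontrivial step run

-- The single path P n has height ⌈log₂ n⌉.
lemma3p1 : (n : ℕ) → 1 ≤ n →
    Σ ℕ (λ d → Run (n ∷ []) d) × (∀ d → Run (n ∷ []) d → d ≡ ⌈log₂ n ⌉)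
lemma3p1 n _ = run-exists (height (n ∷ [])) (n ∷ []) refl
  , λ d run → trans (run-length run) (⊔-identityʳ ⌈log₂ n ⌉)
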